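{- Let $G$ be a cograph. If $G$ is $C_4$-free and contains $P_3$, $2K_2$ and $K_3$ as induced subgraphs, then $G$ contains as an induced subgraph one of $S_1 = P_3 \cup K_3$, $S_2 = $ the butterfly, $S_3 = K_2 \cup \mathrm{paw}$, or $S_4 = K_2 \cup \mathrm{diamond}$.
   Context: Graphs are finite and simple. A cograph is a graph with no induced $P_4$. $K_n$, $C_n$, $P_n$ denote the complete graph, cycle and path on $n$ vertices; $G\cup H$ is the disjoint union and $kG$ the disjoint union of $k$ copies of $G$. With $\oplus$ the join (disjoint union plus all edges between the two parts): the butterfly is $K_1 \oplus 2K_2$, the paw is $K_1 \oplus (K_1 \cup K_2)$, and the diamond is $K_2 \oplus 2K_1$. $H$-free means no induced subgraph isomorphic to $H$. -}

module Defs where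

open import Data.Nat using (ℕ)
open import Data.Fin using (Fin; _≟_)
open import Data.Fin.Patterns using (0F; 1F; 2F; 3F; 4F; 5F)
open import Data.Bool using (Bool; true; false; _∧_; _∨_)
open import Data.List using (List; []; _∷_)
open import Data.Bool.ListAction using (any)
open import Data.Empty using (⊥)
open import Data.Product using (_×_; _,_; Σ; ∃)
open import Relation.Nullary.Decidable using (⌊_⌋)
open import Relation.Binary.PropositionalEquality using (_≡_)
open import Function.Definitions using (Injective)

record Graph (n : ℕ) : Set where
  field
    adj    : Fin n → Fin n → Bool
    sym    : ∀ i j → adj i j ≡ adj j i
    irrefl : ∀ i → adj i i ≡ false
open Graph public

edgesAdj : ∀ {m} → List (Fin m × Fin m) → Fin m → Fin m → Bool
edgesAdj es i j =
  any (λ { (a , b) → (⌊ a ≟ i ⌋ ∧ ⌊ b ≟ j ⌋) ∨ (⌊ a ≟ j ⌋ ∧ ⌊ b ≟ i ⌋) }) es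

InducedIn : ∀ {m} → (Fin m → Fin m → Bool) → ∀ {n} → Graph n → Set
InducedIn {m} H {n} G =
  Σ (Fin m → Fin n) λ f →
    Injective _≡_ _≡_ f × (∀ i j → adj G (f i) (f j) ≡ H i j)

Free : ∀ {m} → (Fin m → Fin m → Bool) → ∀ {n} → Graph n → Set
Free H G = InducedIn H G → ⊥

P3 : Fin 3 → Fin 3 → Bool
P3 = edgesAdj ((0F , 1F) ∷ (1F , 2F) ∷ [])

P4 : Fin 4 → Fin 4 → Bool
P4 = edgesAdj ((0F , 1F) ∷ (1F , 2F) ∷ (2F , 3F) ∷ [])

C4 : Fin 4 → Fin 4 → Bool
C4 = edgesAdj ((0F , 1F) ∷ (1F , 2F) ∷ (2F , 3F) ∷ (3F , 0F) ∷ [])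

K3 : Fin 3 → Fin 3 → Bool
K3 = edgesAdj ((0F , 1F) ∷ (1F , 2F) ∷ (0F , 2F) ∷ [])

twoK2 : Fin 4 → Fin 4 → Bool
twoK2 = edgesAdj ((0F , 1F) ∷ (2F , 3F) ∷ [])

S1 : Fin 6 → Fin 6 → Bool
S1 = edgesAdj ((0F , 1F) ∷ (1F , 2F) ∷ (3F , 4F) ∷ (4F , 5F) ∷ (3F , 5F) ∷ [])

-- S₂ = butterfly K₁ ⊕ 2K₂ (centre 0, edges 1-2 and 3-4)
S2 : Fin 5 → Fin 5 → Bool
S2 = edgesAdj ((1F , 2F) ∷ (3F , 4F) ∷
               (0F , 1F) ∷ (0F , 2F) ∷ (0F , 3F) ∷ (0F , 4F) ∷ [])

-- S₃ = K₂ ∪ paw, paw = K₁ ⊕ (K₁ ∪ K₂) (K₂ = 0-1; paw centre 2, isolated 3, edge 4-5)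
S3 : Fin 6 → Fin 6 → Bool
S3 = edgesAdj ((0F , 1F) ∷ (4F , 5F) ∷ (2F , 3F) ∷ (2F , 4F) ∷ (2F , 5F) ∷ [])

-- S₄ = K₂ ∪ diamond, diamond = K₂ ⊕ 2K₁ (K₂ = 0-1; diamond edge 2-3, joined to 4,5)
S4 : Fin 6 → Fin 6 → Bool
S4 = edgesAdj ((0F , 1F) ∷ (2F , 3F) ∷
               (2F , 4F) ∷ (2F , 5F) ∷ (3F , 4F) ∷ (3F , 5F) ∷ [])

Cograph : ∀ {n} → Graph n → Set
Cograph G = Free P4 G

-- In a cograph every connected component has diameter at most 2, so two
-- vertices at distance at least 3 lie in different components.  Take the
-- two edges ab, cd of an induced 2K₂.  If a and c have a common neighbour w,
-- P₄-freeness makes w adjacent to b and d as well: a butterfly.  Otherwise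
-- ab and cd lie in different components, so one of them is an edge in a
-- component other than that of the triangle xyz.  If the centre of the P₃
-- is also outside the triangle's component we get P₃ ∪ K₃.  Otherwise the
-- P₃ shows that the triangle's component contains a vertex adjacent to
-- exactly one or two corners, a vertex complete to the triangle with a
-- neighbour anticomplete to it, or two non-adjacent vertices complete to
-- it.  This yields a paw or a diamond, which together with the distant
-- edge is K₂ ∪ paw or K₂ ∪ diamond.
module Submission where

open import Defs hiding (sym)
open import Data.Nat using (ℕ; _+_)
open import Data.Fin using (Fin; _≟_; splitAt; join)
open import Data.Fin.Patterns using (0F; 1F; 2F; 3F)
open import Data.Fin.Properties using (all?; any?; join-splitAt)
open import Data.Bool using (Bool; true; false)
open import Data.Bool.Properties using (¬-not; not-¬) renaming (_≟_ to _≟ᵇ_)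
open import Data.Product using (_×_; _,_; ∃-syntax; ∃₂; proj₁; proj₂)
open import Data.Sum using (_⊎_; inj₁; inj₂; [_,_]′)
open import Function using (_∘_)
open import Function.Definitions using (Injective)
open import Relation.Nullary using (¬_; Dec; yes; no; contradiction)
open import Relation.Nullary.Decidable using (from-yes; _×-dec_; _⊎-dec_)
open import Relation.Binary.PropositionalEquality
  using (_≡_; _≢_; refl; sym; trans; cong; ≢-sym; module ≡-Reasoning)

Adj : ℕ → Set
Adj m = Fin m → Fin m → Bool

infix 4 _≐_ _≐?_
infixr 6 _∪_ _⊕_

_≐_ : ∀ {m} → Adj m → Adj m → Set
A ≐ B = ∀ i j → A i j ≡ B i j

_≐?_ : ∀ {m} (A B : Adj m) → Dec (A ≐ B)
A ≐? B = all? λ i → all? λ j → A i j ≟ᵇ B i j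

glue⊎ : ∀ {a b} → Adj a → Adj b → (Fin a → Fin b → Bool) →
        Fin a ⊎ Fin b → Fin a ⊎ Fin b → Bool
glue⊎ A B C (inj₁ i) (inj₁ j) = A i j
glue⊎ A B C (inj₁ i) (inj₂ j) = C i j
glue⊎ A B C (inj₂ i) (inj₁ j) = C j i
glue⊎ A B C (inj₂ i) (inj₂ j) = B i j

glue : ∀ {a b} → Adj a → Adj b → (Fin a → Fin b → Bool) → Adj (a + b)
glue {a} A B C i j = glue⊎ A B C (splitAt a i) (splitAt a j)

_∪_ _⊕_ : ∀ {a b} → Adj a → Adj b → Adj (a + b)
A ∪ B = glue A B λ _ _ → false
A ⊕ B = glue A B λ _ _ → true

K1 : Adj 1
K1 _ _ = false

K2 twoK1 : Adj 2
K2    = K1 ⊕ K1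
twoK1 = K1 ∪ K1

paw diamond : Adj 4
paw     = K1 ⊕ (K1 ∪ K2)
diamond = K2 ⊕ twoK1

link : Fin 2 → Fin 2 → Bool
link 1F 0F = true
link _  _  = false

P4-glued : glue K2 K2 link ≐ P4
P4-glued = from-yes (glue K2 K2 link ≐? P4)

S1-glued : P3 ∪ K3 ≐ S1
S1-glued = from-yes (P3 ∪ K3 ≐? S1)

S2-glued : K1 ⊕ twoK2 ≐ S2
S2-glued = from-yes (K1 ⊕ twoK2 ≐? S2)

S3-glued : K2 ∪ paw ≐ S3
S3-glued = from-yes (K2 ∪ paw ≐? S3)

S4-glued : K2 ∪ diamond ≐ S4
S4-glued = from-yes (K2 ∪ diamond ≐? S4)

Dominating : ∀ {m} → Adj m → Fin m → Set
Dominating H d = ∀ i → i ≡ d ⊎ H d i ≡ true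

dominating? : ∀ {m} (H : Adj m) d → Dec (Dominating H d)
dominating? H d = all? λ i → (i ≟ d) ⊎-dec (H d i ≟ᵇ true)

module Induced {n} (G : Graph n) where

  _⟨_⟩ : ∀ {m} {H : Adj m} → InducedIn H G → Fin m → Fin n
  φ ⟨ i ⟩ = proj₁ φ i

  adjacency : ∀ {m} {H : Adj m} (φ : InducedIn H G) →
    ∀ i j → adj G (φ ⟨ i ⟩) (φ ⟨ j ⟩) ≡ H i j
  adjacency φ = proj₂ (proj₂ φ)

  distinct : ∀ {m} {H : Adj m} (φ : InducedIn H G) →
    ∀ {i j} → i ≢ j → φ ⟨ i ⟩ ≢ φ ⟨ j ⟩
  distinct φ i≢j = i≢j ∘ proj₁ (proj₂ φ)

  induced-resp : ∀ {m} {A B : Adj m} → A ≐ B → InducedIn A G → InducedIn B G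
  induced-resp A≐B (f , f-inj , f-adj) = f , f-inj , λ i j → trans (f-adj i j) (A≐B i j)

  E N : Fin n → Fin n → Set
  E u v = adj G u v ≡ true
  N u v = adj G u v ≡ false

  E-sym : ∀ {u v} → E u v → E v u
  E-sym {u} {v} = trans (Graph.sym G v u)

  N-sym : ∀ {u v} → N u v → N v u
  N-sym {u} {v} = trans (Graph.sym G v u)

  E⇒¬N : ∀ {u v} → E u v → ¬ N u v
  E⇒¬N = not-¬

  E⇒≢ : ∀ {u v} → E u v → u ≢ v
  E⇒≢ {u} uv refl = E⇒¬N uv (irrefl G u)

  separated : ∀ {u v w} → N u w → E v w → u ≢ v
  separated uw vw refl = E⇒¬N vw uw

  induced-glue : ∀ {a b} {A : Adj a} {B : Adj b} {C : Fin a → Fin b → Bool}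
    (φ : InducedIn A G) (ψ : InducedIn B G) →
    (∀ i j → adj G (φ ⟨ i ⟩) (ψ ⟨ j ⟩) ≡ C i j) →
    (∀ i j → C i j ≡ false → φ ⟨ i ⟩ ≢ ψ ⟨ j ⟩) →
    InducedIn (glue A B C) G
  induced-glue {a} {b} {A} {B} {C} φ ψ cross apart =
    f ∘ splitAt a , f-inj , λ i j → f-adj (splitAt a i) (splitAt a j)
    where
    f : Fin a ⊎ Fin b → Fin n
    f = [ φ ⟨_⟩ , ψ ⟨_⟩ ]′

    cross-≢ : ∀ i j → φ ⟨ i ⟩ ≢ ψ ⟨ j ⟩
    cross-≢ i j with C i j in cᵢⱼ
    ... | true  = E⇒≢ (trans (cross i j) cᵢⱼ)
    ... | false = apart i j cᵢⱼ

    f-inj⊎ : ∀ u v → f u ≡ f v → u ≡ v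
    f-inj⊎ (inj₁ i) (inj₁ j) eq = cong inj₁ (proj₁ (proj₂ φ) eq)
    f-inj⊎ (inj₁ i) (inj₂ j) eq = contradiction eq (cross-≢ i j)
    f-inj⊎ (inj₂ i) (inj₁ j) eq = contradiction (sym eq) (cross-≢ j i)
    f-inj⊎ (inj₂ i) (inj₂ j) eq = cong inj₂ (proj₁ (proj₂ ψ) eq)

    f-inj : Injective _≡_ _≡_ (f ∘ splitAt a)
    f-inj {i} {j} eq = begin
      i                      ≡⟨ sym (join-splitAt a b i) ⟩
      join a b (splitAt a i) ≡⟨ cong (join a b) (f-inj⊎ (splitAt a i) (splitAt a j) eq) ⟩
      join a b (splitAt a j) ≡⟨ join-splitAt a b j ⟩
      j                      ∎
      where open ≡-Reasoning

    f-adj : ∀ u v → adj G (f u) (f v) ≡ glue⊎ A B C u v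
    f-adj (inj₁ i) (inj₁ j) = adjacency φ i j
    f-adj (inj₁ i) (inj₂ j) = cross i j
    f-adj (inj₂ i) (inj₁ j) = trans (Graph.sym G (ψ ⟨ i ⟩) (φ ⟨ j ⟩)) (cross j i)
    f-adj (inj₂ i) (inj₂ j) = adjacency ψ i j

  induced-⊕ : ∀ {a b} {A : Adj a} {B : Adj b} (φ : InducedIn A G) (ψ : InducedIn B G) →
    (∀ i j → E (φ ⟨ i ⟩) (ψ ⟨ j ⟩)) → InducedIn (A ⊕ B) G
  induced-⊕ φ ψ cross = induced-glue φ ψ cross λ _ _ ()

  induced-∪ : ∀ {a b} {A : Adj a} {B : Adj b} (φ : InducedIn A G) (ψ : InducedIn B G) →
    (∀ i j → N (φ ⟨ i ⟩) (ψ ⟨ j ⟩)) → (∀ i j → φ ⟨ i ⟩ ≢ ψ ⟨ j ⟩) →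
    InducedIn (A ∪ B) G
  induced-∪ φ ψ cross apart = induced-glue φ ψ cross λ i j _ → apart i j

  induced-K1 : Fin n → InducedIn K1 G
  induced-K1 v = (λ _ → v) , (λ { {0F} {0F} _ → refl }) , λ { 0F 0F → irrefl G v }

  induced-K2 : ∀ {u v} → E u v → InducedIn K2 G
  induced-K2 {u} {v} uv = induced-⊕ (induced-K1 u) (induced-K1 v) λ { 0F 0F → uv }

  induced-twoK1 : ∀ {u v} → N u v → u ≢ v → InducedIn twoK1 G
  induced-twoK1 {u} {v} uv u≢v =
    induced-∪ (induced-K1 u) (induced-K1 v) (λ { 0F 0F → uv }) λ { 0F 0F → u≢v }

  induced-paw : ∀ {c t u v} → E c t → E c u → E c v → E u v → N t u → N t v →
    InducedIn paw G
  induced-paw {c} {t} ct cu cv uv tu tv =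
    induced-⊕ (induced-K1 c)
      (induced-∪ (induced-K1 t) (induced-K2 uv)
        (λ { 0F 0F → tu ; 0F 1F → tv })
        (λ { 0F 0F → separated tv uv ; 0F 1F → separated tu (E-sym uv) }))
      λ { 0F 0F → ct ; 0F 1F → cu ; 0F 2F → cv }

  induced-diamond : ∀ {u v s t} → E u v → E u s → E u t → E v s → E v t →
    N s t → s ≢ t → InducedIn diamond G
  induced-diamond uv us ut vs vt st s≢t =
    induced-⊕ (induced-K2 uv) (induced-twoK1 st s≢t)
      λ { 0F 0F → us ; 0F 1F → ut ; 1F 0F → vs ; 1F 1F → vt }

  induced-P4 : ∀ {a b c d} → E a b → E b c → E c d → N a c → N a d → N b d →
    a ≢ c → a ≢ d → b ≢ d → InducedIn P4 G
  induced-P4 ab bc cd ac ad bd a≢c a≢d b≢d =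
    induced-resp P4-glued
      (induced-glue (induced-K2 ab) (induced-K2 cd)
        (λ { 0F 0F → ac ; 0F 1F → ad ; 1F 0F → bc ; 1F 1F → bd })
        (λ { 0F 0F _ → a≢c ; 0F 1F _ → a≢d ; 1F 1F _ → b≢d ; 1F 0F () }))

  Close Near Far : Fin n → Fin n → Set
  Close s t = s ≡ t ⊎ E s t
  Near  s t = s ≡ t ⊎ E s t ⊎ ∃[ w ] E s w × E w t
  Far   s t = ¬ Near s t

  near? : ∀ s t → Dec (Near s t)
  near? s t = s ≟ t ⊎-dec E? s t ⊎-dec any? λ w → E? s w ×-dec E? w t
    where
    E? : ∀ u v → Dec (E u v)
    E? u v = adj G u v ≟ᵇ true

  near-sym : ∀ {s t} → Near s t → Near t s
  near-sym (inj₁ s≡t)               = inj₁ (sym s≡t)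
  near-sym (inj₂ (inj₁ st))         = inj₂ (inj₁ (E-sym st))
  near-sym (inj₂ (inj₂ (w , sw , wt))) = inj₂ (inj₂ (w , E-sym wt , E-sym sw))

  far-sym : ∀ {s t} → Far s t → Far t s
  far-sym far = far ∘ near-sym

  far⇒N : ∀ {s t} → Far s t → N s t
  far⇒N far = ¬-not (far ∘ inj₂ ∘ inj₁)

  close-to-dominating : ∀ {m} {H : Adj m} {d} (φ : InducedIn H G) →
    Dominating H d → ∀ i → Close (φ ⟨ d ⟩) (φ ⟨ i ⟩)
  close-to-dominating φ dom i with dom i
  ... | inj₁ refl = inj₁ refl
  ... | inj₂ di   = inj₂ (trans (adjacency φ _ i) di)

  module Cograph-facts (cograph : Cograph G) where

    -- b-a-w-c would be an induced P₄.
    forced-edge : ∀ {a b c w} → E b a → E a w → E w c → N b c → N a c → E b w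
    forced-edge {b = b} {w = w} ba aw wc bc ac with adj G b w in bw
    ... | true  = refl
    ... | false = contradiction
          (induced-P4 ba aw wc bw bc ac
            (separated bc wc)
            (≢-sym (separated (N-sym ac) ba))
            (≢-sym (separated (N-sym bc) (E-sym ba))))
          cograph

    far-step : ∀ {s s' t} → Far s t → E s s' → Far s' t
    far-step {s} {s'} {t} far ss' = far ∘ near-through-s'
      where
      near-through-s' : Near s' t → Near s t
      near-through-s' (inj₁ refl)                   = inj₂ (inj₁ ss')
      near-through-s' (inj₂ (inj₁ s't))             = inj₂ (inj₂ (s' , ss' , s't))
      near-through-s' (inj₂ (inj₂ (w , s'w , wt))) with adj G s' t in s't
      ... | true  = inj₂ (inj₂ (s' , ss' , s't))
      ... | false = inj₂ (inj₂ (w , forced-edge ss' s'w wt (far⇒N far) s't , wt))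

    far-close : ∀ {s s' t} → Close s s' → Far s t → Far s' t
    far-close (inj₁ refl) far = far
    far-close (inj₂ ss')  far = far-step far ss'

    near-far : ∀ {s t u} → Near s t → Far t u → Far s u
    near-far (inj₁ refl)                 far = far
    near-far (inj₂ (inj₁ st))            far = far-step far (E-sym st)
    near-far (inj₂ (inj₂ (w , sw , wt))) far = far-step (far-step far (E-sym wt)) (E-sym sw)

    induced-∪-far : ∀ {a b} {A : Adj a} {B : Adj b} {c d}
      (φ : InducedIn A G) (ψ : InducedIn B G) → Dominating A c → Dominating B d →
      Far (φ ⟨ c ⟩) (ψ ⟨ d ⟩) → InducedIn (A ∪ B) G
    induced-∪-far φ ψ A-dom B-dom far =
      induced-∪ φ ψ (λ i j → far⇒N (spread i j)) λ i j eq → spread i j (inj₁ eq)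
      where
      spread : ∀ i j → Far (φ ⟨ i ⟩) (ψ ⟨ j ⟩)
      spread i j = far-sym (far-close (close-to-dominating ψ B-dom j)
                    (far-sym (far-close (close-to-dominating φ A-dom i) far)))

    butterfly-or-far : (κ : InducedIn twoK2 G) →
      InducedIn S2 G ⊎ Far (κ ⟨ 0F ⟩) (κ ⟨ 2F ⟩)
    butterfly-or-far κ with near? (κ ⟨ 0F ⟩) (κ ⟨ 2F ⟩)
    ... | no far                        = inj₂ far
    ... | yes (inj₁ a≡c)                = contradiction a≡c (distinct κ λ ())
    ... | yes (inj₂ (inj₁ ac))          = contradiction (adjacency κ 0F 2F) (E⇒¬N ac)
    ... | yes (inj₂ (inj₂ (w , aw , wc))) =
      inj₁ (induced-resp S2-glued (induced-⊕ (induced-K1 w) κ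
        λ { 0F 0F → E-sym aw
          ; 0F 1F → E-sym (forced-edge (E-sym (adjacency κ 0F 1F)) aw wc
                                (adjacency κ 1F 2F) (adjacency κ 0F 2F))
          ; 0F 2F → wc
          ; 0F 3F → E-sym (forced-edge (E-sym (adjacency κ 2F 3F)) (E-sym wc) (E-sym aw)
                                (adjacency κ 3F 0F) (adjacency κ 2F 0F)) }))

    far-edge : (κ : InducedIn twoK2 G) → Far (κ ⟨ 0F ⟩) (κ ⟨ 2F ⟩) →
      ∀ x → ∃₂ λ e e' → E e e' × Far x e
    far-edge κ far x with near? x (κ ⟨ 0F ⟩)
    ... | yes x~a = κ ⟨ 2F ⟩ , κ ⟨ 3F ⟩ , adjacency κ 2F 3F , near-far x~a far
    ... | no  x≁a = κ ⟨ 0F ⟩ , κ ⟨ 1F ⟩ , adjacency κ 0F 1F , x≁a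

    S1-from-far : (π : InducedIn P3 G) (τ : InducedIn K3 G) →
      Far (π ⟨ 1F ⟩) (τ ⟨ 0F ⟩) → InducedIn S1 G
    S1-from-far π τ far =
      induced-resp S1-glued (induced-∪-far π τ (from-yes (dominating? P3 1F))
                                               (from-yes (dominating? K3 0F)) far)

    Result : Set
    Result = InducedIn S3 G ⊎ InducedIn S4 G

    module _ {e e'} (ee' : E e e') where

      paw-beside : ∀ {a b c v} → Far a e → E a b → E a c → E b c → E a v →
        N v b → N v c → Result
      paw-beside far ab ac bc av vb vc =
        inj₁ (induced-resp S3-glued
          (induced-∪-far (induced-K2 ee') (induced-paw av ab ac bc vb vc)
            (from-yes (dominating? K2 0F)) (from-yes (dominating? paw 0F)) (far-sym far)))

      diamond-beside : ∀ {a b c v} → Far a e → E a b → E a c → E b c →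
        E a v → E b v → N c v → c ≢ v → Result
      diamond-beside far ab ac bc av bv cv c≢v =
        inj₂ (induced-resp S4-glued
          (induced-∪-far (induced-K2 ee') (induced-diamond ab ac av bc bv cv c≢v)
            (from-yes (dominating? K2 0F)) (from-yes (dominating? diamond 0F)) (far-sym far)))

      module _ {x y z} (xy : E x y) (yz : E y z) (xz : E x z) (x-far : Far x e) where

        data Corner : Fin n → Set where
          is-x : Corner x
          is-y : Corner y
          is-z : Corner z

        data Inner (v : Fin n) : Set where
          corner   : Corner v → Inner v
          complete : E v x → E v y → E v z → Inner v

        data Attachment (v : Fin n) : Set where
          inner        : Inner v → Attachment v
          anticomplete : N v x → N v y → N v z → Attachment v

        y-far : Far y e
        y-far = far-step x-far xy

        z-far : Far z e
        z-far = far-step x-far xz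

        attach : ∀ v → Result ⊎ Attachment v
        attach v with v ≟ x | v ≟ y | v ≟ z
        ... | yes refl | _        | _        = inj₂ (inner (corner is-x))
        ... | no _     | yes refl | _        = inj₂ (inner (corner is-y))
        ... | no _     | no _     | yes refl = inj₂ (inner (corner is-z))
        ... | no v≢x   | no v≢y   | no v≢z
            with adj G v x in vx | adj G v y in vy | adj G v z in vz
        ... | true  | true  | true  = inj₂ (inner (complete vx vy vz))
        ... | false | false | false = inj₂ (anticomplete vx vy vz)
        ... | true  | false | false = inj₁ (paw-beside x-far xy xz yz (E-sym vx) vy vz)
        ... | false | true  | false = inj₁ (paw-beside y-far (E-sym xy) yz xz (E-sym vy) vx vz)
        ... | false | false | true  =
          inj₁ (paw-beside z-far (E-sym xz) (E-sym yz) xy (E-sym vz) vx vy)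
        ... | true  | true  | false =
          inj₁ (diamond-beside x-far xy xz yz (E-sym vx) (E-sym vy) (N-sym vz) (≢-sym v≢z))
        ... | true  | false | true  =
          inj₁ (diamond-beside x-far xz xy (E-sym yz) (E-sym vx) (E-sym vz) (N-sym vy)
                               (≢-sym v≢y))
        ... | false | true  | true  =
          inj₁ (diamond-beside y-far yz (E-sym xy) (E-sym xz) (E-sym vy) (E-sym vz) (N-sym vx)
                     (≢-sym v≢x))

        corner-adjacent : ∀ {p r} → Corner p → Inner r → p ≢ r → E p r
        corner-adjacent is-x (corner is-x) x≢x = contradiction refl x≢x
        corner-adjacent is-x (corner is-y) _   = xy
        corner-adjacent is-x (corner is-z) _   = xz
        corner-adjacent is-y (corner is-x) _   = E-sym xy
        corner-adjacent is-y (corner is-y) y≢y = contradiction refl y≢y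
        corner-adjacent is-y (corner is-z) _   = yz
        corner-adjacent is-z (corner is-x) _   = E-sym xz
        corner-adjacent is-z (corner is-y) _   = E-sym yz
        corner-adjacent is-z (corner is-z) z≢z = contradiction refl z≢z
        corner-adjacent is-x (complete rx _ _) _ = E-sym rx
        corner-adjacent is-y (complete _ ry _) _ = E-sym ry
        corner-adjacent is-z (complete _ _ rz) _ = E-sym rz

        inner-nonadjacent : ∀ {p r} → Inner p → Inner r → N p r → p ≢ r → Result
        inner-nonadjacent (corner p) r pr p≢r =
          contradiction (corner-adjacent p r p≢r) (λ e → E⇒¬N e pr)
        inner-nonadjacent p@(complete _ _ _) (corner r) pr p≢r =
          contradiction (corner-adjacent r p (≢-sym p≢r)) (λ e → E⇒¬N e (N-sym pr))
        inner-nonadjacent (complete px py _) (complete rx ry _) pr p≢r =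
          diamond-beside x-far xy (E-sym px) (E-sym py) (E-sym rx) (E-sym ry) pr p≢r

        anticomplete-neighbour : ∀ {a w} → N a x → N a y → N a z → Inner w → E a w →
          Result
        anticomplete-neighbour ax _ _ (corner is-x) aw = contradiction ax (E⇒¬N aw)
        anticomplete-neighbour _ ay _ (corner is-y) aw = contradiction ay (E⇒¬N aw)
        anticomplete-neighbour _ _ az (corner is-z) aw = contradiction az (E⇒¬N aw)
        anticomplete-neighbour ax ay _ (complete wx wy _) aw =
          paw-beside (far-step x-far (E-sym wx)) wx wy xy (E-sym aw) ax ay

        anticomplete-near : ∀ {q} → N q x → N q y → N q z → Near q x → Result
        anticomplete-near _  qy _ (inj₁ refl)      = contradiction qy (E⇒¬N xy)
        anticomplete-near qx _  _ (inj₂ (inj₁ qx')) = contradiction qx (E⇒¬N qx')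
        anticomplete-near qx qy qz (inj₂ (inj₂ (w , qw , wx))) with attach w
        ... | inj₁ found               = found
        ... | inj₂ (inner w-inner)     = anticomplete-neighbour qx qy qz w-inner qw
        ... | inj₂ (anticomplete wx' _ _) = contradiction wx' (E⇒¬N wx)

        path-near-triangle : ∀ {p q r} → E p q → E q r → N p r → p ≢ r → Near q x →
          Result
        path-near-triangle {p} {q} {r} pq qr pr p≢r q~x with attach q
        ... | inj₁ found                     = found
        ... | inj₂ (anticomplete qx qy qz)   = anticomplete-near qx qy qz q~x
        ... | inj₂ (inner q-inner) with attach p | attach r
        ...   | inj₁ found | _          = found
        ...   | _          | inj₁ found = found
        ...   | inj₂ (anticomplete px py pz) | _ = anticomplete-neighbour px py pz q-inner pq
        ...   | _ | inj₂ (anticomplete rx ry rz) =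
          anticomplete-neighbour rx ry rz q-inner (E-sym qr)
        ...   | inj₂ (inner p-inner) | inj₂ (inner r-inner) =
          inner-nonadjacent p-inner r-inner pr p≢r

    S3-or-S4 : ∀ {e e'} → E e e' → (τ : InducedIn K3 G) → Far (τ ⟨ 0F ⟩) e →
      (π : InducedIn P3 G) → Near (π ⟨ 1F ⟩) (τ ⟨ 0F ⟩) → Result
    S3-or-S4 ee' τ far π near =
      path-near-triangle ee' (adjacency τ 0F 1F) (adjacency τ 1F 2F) (adjacency τ 0F 2F) far
        (adjacency π 0F 1F) (adjacency π 1F 2F) (adjacency π 0F 2F) (distinct π λ ()) near

lemma3 : ∀ {n} (G : Graph n) → Cograph G → Free C4 G →
    InducedIn P3 G → InducedIn twoK2 G → InducedIn K3 G →
    InducedIn S1 G ⊎ InducedIn S2 G ⊎ InducedIn S3 G ⊎ InducedIn S4 G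
lemma3 G cograph _ π κ τ = outline
  where
  open Induced G
  open Cograph-facts cograph

  outline : InducedIn S1 G ⊎ InducedIn S2 G ⊎ InducedIn S3 G ⊎ InducedIn S4 G
  outline with near? (π ⟨ 1F ⟩) (τ ⟨ 0F ⟩)
  ... | no q-far = inj₁ (S1-from-far π τ q-far)
  ... | yes q-near with butterfly-or-far κ
  ...   | inj₁ butterfly = inj₂ (inj₁ butterfly)
  ...   | inj₂ ac-far with far-edge κ ac-far (τ ⟨ 0F ⟩)
  ...     | _ , _ , ee' , x-far = inj₂ (inj₂ (S3-or-S4 ee' τ x-far π q-near))
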